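{- Let $q=2^m$ and let $f(x)\in\mathrm{GF}(q)[x]$ be an o-polynomial. For $u_1,u_2,u_3\in\mathrm{GF}(q)$ with $(u_1+u_2)(u_2+u_3)(u_3+u_1)\neq 0$, define $$I(u_1,u_2,u_3)=\left\{(a,b,c)\in\mathrm{GF}(q)^3:\ ab\neq 0,\ \{u_1,u_2,u_3\}\subseteq V(af(x)+bx+c)\right\}.$$ Then $|I(u_1,u_2,u_3)|=\frac{q(q-1)(q-4)}{8}$.
   Context: For a polynomial $g$ over $\mathrm{GF}(q)$, its value set is $V(g)=\{g(x): x\in\mathrm{GF}(q)\}$. With $q=2^m$, an o-polynomial over $\mathrm{GF}(q)$ is a polynomial $f\in\mathrm{GF}(q)[x]$ with $\deg f<q$, $f(0)=0$, $f$ a permutation of $\mathrm{GF}(q)$, and such that for every $a\in\mathrm{GF}(q)$ the polynomial $(f(x+a)+f(a))x^{q-2}$ is also a permutation of $\mathrm{GF}(q)$ (the normalization $f(1)=1$ is not required). -}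

module Defs where

open import Level using (Level; suc; _⊔_) renaming (zero to lzero)
open import Data.Nat using (ℕ; _^_; _∸_)
import Data.Nat as ℕ
open import Data.Fin using (Fin)
open import Data.Fin.Properties using () 
open import Data.Bool using (Bool; true; false; _∧_; not)
open import Data.List using (List; []; _∷_; map; cartesianProduct)
open import Data.Bool.ListAction using (any)
open import Data.List using () renaming (allFin to allFinL)
open import Data.Vec using (Vec; []; _∷_)
open import Data.Product using (_×_; _,_)
open import Relation.Binary.PropositionalEquality using (_≡_)
open import Relation.Nullary using (¬_; Dec; yes; no)
open import Relation.Nullary.Decidable using (⌊_⌋)
open import Relation.Unary using (Pred; Decidable)
open import Algebra.Structures using (IsCommutativeRing)
open import Function.Bundles using (_↔_; Inverse)
open import Function.Definitions using (Bijective)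

record GF2^ (m : ℕ) : Set₁ where
  infixl 6 _+_
  infixl 7 _*_
  field
    F        : Set
    _+_ _*_  : F → F → F
    -_       : F → F
    0# 1#    : F
    isCommutativeRing : IsCommutativeRing _≡_ _+_ _*_ -_ 0# 1#
    0≢1      : ¬ (0# ≡ 1#)
    _⁻¹      : F → F
    inverseʳ : ∀ x → ¬ (x ≡ 0#) → x * (x ⁻¹) ≡ 1#
    _≟_      : (x y : F) → Dec (x ≡ y)
    enum     : Fin (2 ^ m) ↔ F

module GFq {m : ℕ} (K : GF2^ m) where
  open GF2^ K public

  q : ℕ
  q = 2 ^ m

  elements : List F
  elements = map (Inverse.to enum) (allFinL q)

  _^ᶠ_ : F → ℕ → F
  x ^ᶠ ℕ.zero  = 1#
  x ^ᶠ ℕ.suc n = x * (x ^ᶠ n)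

  -- polynomials of degree < q: coefficient vectors c₀ … c_{q-1}
  Poly : Set
  Poly = Vec F q

  eval : ∀ {n} → Vec F n → F → F
  eval cs x = go 0 cs
    where
    go : ∀ {n} → ℕ → Vec F n → F
    go i []       = 0#
    go i (c ∷ cs) = c * (x ^ᶠ i) + go (ℕ.suc i) cs

  IsPermutation : (F → F) → Set
  IsPermutation g = Bijective _≡_ _≡_ g

  -- o-polynomial over GF(q), q = 2^m (normalisation f(1)=1 not required)
  record IsOPolynomial (f : Poly) : Set where
    field
      zero-at-0 : eval f 0# ≡ 0#
      perm      : IsPermutation (eval f)
      perm-a    : ∀ a → IsPermutation (λ x → (eval f (x + a) + eval f a) * (x ^ᶠ (q ∸ 2)))

  inValueSet : (F → F) → F → Bool
  inValueSet g u = any (λ x → ⌊ g x ≟ u ⌋) elements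

  nonzero : F → Bool
  nonzero x = not ⌊ x ≟ 0# ⌋

  inI : Poly → F → F → F → F × F × F → Bool
  inI f u₁ u₂ u₃ (a , b , c) =
    nonzero (a * b) ∧
    (inValueSet g u₁ ∧ (inValueSet g u₂ ∧ inValueSet g u₃))
    where
    g : F → F
    g x = a * eval f x + b * x + c

  triples : List (F × F × F)
  triples = cartesianProduct elements (cartesianProduct elements elements)

  countTrue : {A : Set} → (A → Bool) → List A → ℕ
  countTrue p []       = 0
  countTrue p (x ∷ xs) with p x
  ... | true  = ℕ.suc (countTrue p xs)
  ... | false = countTrue p xs

  cardI : Poly → F → F → F → ℕ
  cardI f u₁ u₂ u₃ = countTrue (inI f u₁ u₂ u₃) triples

module Submission where

-- Write g(x) = a f(x) + b x + c and let N(a, b, c) be the number of (x₁, x₂, x₃) with g(xᵢ) = uᵢ.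
--  * If ab ≠ 0, g is two-to-one: g(x) = g(y) with x ≠ y means that the slope of f at y towards x
--    is b / a, and by the o-polynomial condition this slope is a bijection of x. So each uᵢ has
--    2 or 0 preimages and N = 8 · [(a, b, c) ∈ I].
--  * If exactly one of a, b is 0, g is a bijection and N = 1; if a = b = 0, g is constant and N = 0.
--  * For pairwise distinct x₁, x₂, x₃ exactly one (a, b, c) satisfies g(xᵢ) = uᵢ, by Cramer's rule
--    (the determinant is nonzero, again by the slope condition); otherwise none does.
-- Counting all solutions (a, b, c, x₁, x₂, x₃) in both orders gives
-- q (q - 1) (q - 2) = 8 |I| + 2 q (q - 1).

open import Defs
open import Data.Nat using (ℕ; _∸_; _/_) renaming (_*_ to _*ℕ_)
open import Relation.Binary.PropositionalEquality using (_≡_)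
open import Relation.Nullary using (¬_)

open import Data.Nat using (zero; suc; _^_) renaming (_+_ to _+ℕ_)
import Data.Nat.Properties as ℕP
open import Data.Nat.DivMod using (m*n/n≡m)
open import Data.Nat.Tactic.RingSolver using (solve-∀)
open import Data.Bool using (Bool; true; false; _∧_; T; _xor_)
open import Data.Unit using (tt)
open import Data.List using (List; []; _∷_; map; _++_; cartesianProduct; tabulate; allFin)
open import Data.List.Relation.Unary.Any using (satisfied)
open import Data.List.Relation.Unary.Any.Properties using (any⁺; any⁻)
open import Data.List.Membership.Propositional using (_∈_; lose)
open import Data.List.Membership.Propositional.Properties using (∈-map⁺; ∈-allFin)
open import Data.Fin using (Fin) renaming (zero to fzero; suc to fsuc)
import Data.Fin as Fin
import Data.Fin.Properties as FinP
import Data.Fin.Permutation as Perm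
open import Data.Product using (_×_; _,_; proj₁; proj₂; ∃)
open import Data.Sum using (_⊎_; inj₁; inj₂; [_,_])
open import Data.Empty using (⊥-elim)
open import Data.Maybe using (Maybe; just; nothing)
open import Relation.Binary.PropositionalEquality
  using (_≢_; refl; sym; trans; cong; cong₂; subst; module ≡-Reasoning)
open import Relation.Binary.Definitions using (tri<; tri≈; tri>)
open import Relation.Nullary using (Dec; yes; no)
open import Relation.Nullary.Decidable using (⌊_⌋; _×-dec_; _⊎-dec_; ¬?; toWitness; fromWitness)
open import Function using (_∘_; _⇔_; mk⇔; Equivalence)
open import Function.Bundles using (Inverse)
open import Algebra.Bundles using (CommutativeRing; RawRing)
import Algebra.Properties.Semiring.Sum as SemiringSum
import Algebra.Properties.CommutativeMonoid.Sum as CommutativeMonoidSum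
import Algebra.Properties.Group as GroupProperties
import Algebra.Solver.Ring as RingSolver
import Algebra.Solver.Ring.AlmostCommutativeRing as ACR
open import Algebra.Structures using (IsCommutativeRing)

χ : Bool → ℕ
χ true  = 1
χ false = 0

𝟙 : {P : Set} → Dec P → ℕ
𝟙 d = χ ⌊ d ⌋

χ-∧ : ∀ x y → χ (x ∧ y) ≡ χ x *ℕ χ y
χ-∧ true  y = sym (ℕP.*-identityˡ (χ y))
χ-∧ false y = refl

𝟙-yes : {P : Set} (d : Dec P) → P → 𝟙 d ≡ 1
𝟙-yes (yes _) _ = refl
𝟙-yes (no ¬p) p = ⊥-elim (¬p p)

𝟙-no : {P : Set} (d : Dec P) → ¬ P → 𝟙 d ≡ 0
𝟙-no (yes p) ¬p = ⊥-elim (¬p p)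
𝟙-no (no _)  _  = refl

𝟙-cong : {P Q : Set} (d : Dec P) (e : Dec Q) → (P → Q) → (Q → P) → 𝟙 d ≡ 𝟙 e
𝟙-cong (yes _) (yes _) _ _ = refl
𝟙-cong (yes p) (no ¬q) f _ = ⊥-elim (¬q (f p))
𝟙-cong (no ¬p) (yes q) _ g = ⊥-elim (¬p (g q))
𝟙-cong (no _)  (no _)  _ _ = refl

𝟙-× : {P Q : Set} (d : Dec P) (e : Dec Q) → 𝟙 (d ×-dec e) ≡ 𝟙 d *ℕ 𝟙 e
𝟙-× (yes _) (yes _) = refl
𝟙-× (yes _) (no _)  = refl
𝟙-× (no _)  _       = refl

𝟙-¬ : {P : Set} (d : Dec P) → 𝟙 d +ℕ 𝟙 (¬? d) ≡ 1
𝟙-¬ (yes _) = refl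
𝟙-¬ (no _)  = refl

open SemiringSum ℕP.+-*-semiring
  using (sum; sum-cong-≗; ∑-distrib-+; ∑-comm; sum-permute; *-distribˡ-sum; *-distribʳ-sum; sum-replicate-zero)

sum-const : ∀ n k → sum {n} (λ _ → k) ≡ n *ℕ k
sum-const zero    k = refl
sum-const (suc n) k = cong (k +ℕ_) (sum-const n k)

sum-single : ∀ {n} (t : Fin n → ℕ) (i : Fin n) → (∀ j → j ≢ i → t j ≡ 0) → sum t ≡ t i
sum-single {suc n} t fzero    vanish = begin
    t fzero +ℕ sum (t ∘ fsuc)  ≡⟨ cong (t fzero +ℕ_) (trans (sum-cong-≗ (λ j → vanish (fsuc j) λ ())) (sum-replicate-zero n)) ⟩
    t fzero +ℕ 0               ≡⟨ ℕP.+-identityʳ (t fzero) ⟩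
    t fzero                    ∎
  where open ≡-Reasoning
sum-single {suc n} t (fsuc i) vanish =
  cong₂ _+ℕ_ (vanish fzero λ ()) (sum-single (t ∘ fsuc) i (λ j j≢i → vanish (fsuc j) (j≢i ∘ FinP.suc-injective)))

listSum : {A : Set} → List A → (A → ℕ) → ℕ
listSum []       w = 0
listSum (x ∷ xs) w = w x +ℕ listSum xs w

listSum-cong : {A : Set} (xs : List A) {w v : A → ℕ} → (∀ x → w x ≡ v x) → listSum xs w ≡ listSum xs v
listSum-cong []       w≗v = refl
listSum-cong (x ∷ xs) w≗v = cong₂ _+ℕ_ (w≗v x) (listSum-cong xs w≗v)

listSum-++ : {A : Set} (xs ys : List A) (w : A → ℕ) → listSum (xs ++ ys) w ≡ listSum xs w +ℕ listSum ys w
listSum-++ []       ys w = refl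
listSum-++ (x ∷ xs) ys w = trans (cong (w x +ℕ_) (listSum-++ xs ys w)) (sym (ℕP.+-assoc (w x) _ _))

listSum-map : {A B : Set} (g : A → B) (xs : List A) (w : B → ℕ) → listSum (map g xs) w ≡ listSum xs (w ∘ g)
listSum-map g []       w = refl
listSum-map g (x ∷ xs) w = cong (w (g x) +ℕ_) (listSum-map g xs w)

listSum-cartesianProduct : {A B : Set} (xs : List A) (ys : List B) (w : A × B → ℕ) →
  listSum (cartesianProduct xs ys) w ≡ listSum xs (λ x → listSum ys (λ y → w (x , y)))
listSum-cartesianProduct []       ys w = refl
listSum-cartesianProduct (x ∷ xs) ys w =
  trans (listSum-++ (map (x ,_) ys) _ w)
        (cong₂ _+ℕ_ (listSum-map (x ,_) ys w) (listSum-cartesianProduct xs ys w))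

listSum-tabulate : {A : Set} (n : ℕ) (g : Fin n → A) (w : A → ℕ) → listSum (tabulate g) w ≡ sum (w ∘ g)
listSum-tabulate zero    g w = refl
listSum-tabulate (suc n) g w = cong (w (g fzero) +ℕ_) (listSum-tabulate n (g ∘ fsuc) w)

-- Semiring identities, in the shapes in which they occur in the final count.
eight-cubes : ∀ x y z → 8 *ℕ (1 *ℕ (x *ℕ (y *ℕ z))) ≡ 1 *ℕ (2 *ℕ x *ℕ (2 *ℕ y *ℕ (2 *ℕ z)))
eight-cubes = solve-∀

two-products : ∀ q r → 1 *ℕ (r *ℕ q) +ℕ r *ℕ (1 *ℕ q) ≡ 2 *ℕ (q *ℕ r)
two-products = solve-∀

power-of-two-even : ∀ n (i j : Fin (2 ^ n)) → i ≢ j → ∃ λ k → 2 ^ n ≡ 2 *ℕ k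
power-of-two-even zero    fzero fzero i≢j = ⊥-elim (i≢j refl)
power-of-two-even (suc n) _     _     _   = 2 ^ n , refl

n∸1≡suc[n∸2] : ∀ n (i j : Fin n) → i ≢ j → n ∸ 1 ≡ suc (n ∸ 2)
n∸1≡suc[n∸2] (suc zero)    fzero fzero i≢j = ⊥-elim (i≢j refl)
n∸1≡suc[n∸2] (suc (suc n)) _     _     _   = refl

solve-for-k : ∀ q k → q *ℕ (q ∸ 1) *ℕ (q ∸ 2) ≡ 8 *ℕ k +ℕ 2 *ℕ (q *ℕ (q ∸ 1)) →
              k ≡ q *ℕ (q ∸ 1) *ℕ (q ∸ 4) / 8
solve-for-k q k total = sym (begin
    Y *ℕ (q ∸ 4) / 8                 ≡⟨ cong (λ z → Y *ℕ z / 8) (sym (ℕP.∸-+-assoc q 2 2)) ⟩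
    Y *ℕ (q ∸ 2 ∸ 2) / 8             ≡⟨ cong (_/ 8) (ℕP.*-distribˡ-∸ Y (q ∸ 2) 2) ⟩
    (Y *ℕ (q ∸ 2) ∸ Y *ℕ 2) / 8      ≡⟨ cong (λ z → (z ∸ Y *ℕ 2) / 8) total ⟩
    (8 *ℕ k +ℕ 2 *ℕ Y ∸ Y *ℕ 2) / 8  ≡⟨ cong (λ z → (8 *ℕ k +ℕ 2 *ℕ Y ∸ z) / 8) (ℕP.*-comm Y 2) ⟩
    (8 *ℕ k +ℕ 2 *ℕ Y ∸ 2 *ℕ Y) / 8  ≡⟨ cong (_/ 8) (ℕP.m+n∸n≡m (8 *ℕ k) (2 *ℕ Y)) ⟩
    8 *ℕ k / 8                       ≡⟨ cong (_/ 8) (ℕP.*-comm 8 k) ⟩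
    k *ℕ 8 / 8                       ≡⟨ m*n/n≡m k 8 ⟩
    k                                ∎)
  where
  open ≡-Reasoning
  Y : ℕ
  Y = q *ℕ (q ∸ 1)

module FiniteField {m : ℕ} (K : GF2^ m) where
  open GFq K
  open ≡-Reasoning
  private module R = IsCommutativeRing isCommutativeRing

  ring : CommutativeRing _ _
  ring = record { isCommutativeRing = isCommutativeRing }

  open GroupProperties (CommutativeRing.+-group ring) using (⁻¹-involutive; ε⁻¹≈ε; inverseʳ-unique)

  ⁻¹-inverseˡ : ∀ x → x ≢ 0# → x ⁻¹ * x ≡ 1#
  ⁻¹-inverseˡ x x≢0 = trans (R.*-comm (x ⁻¹) x) (inverseʳ x x≢0)

  *-cancelˡ : ∀ x {y z} → x ≢ 0# → x * y ≡ x * z → y ≡ z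
  *-cancelˡ x {y} {z} x≢0 xy≡xz = begin
    y                    ≡⟨ sym (R.*-identityˡ y) ⟩
    1# * y               ≡⟨ cong (_* y) (sym (⁻¹-inverseˡ x x≢0)) ⟩
    x ⁻¹ * x * y         ≡⟨ R.*-assoc (x ⁻¹) x y ⟩
    x ⁻¹ * (x * y)       ≡⟨ cong (x ⁻¹ *_) xy≡xz ⟩
    x ⁻¹ * (x * z)       ≡⟨ sym (R.*-assoc (x ⁻¹) x z) ⟩
    x ⁻¹ * x * z         ≡⟨ cong (_* z) (⁻¹-inverseˡ x x≢0) ⟩
    1# * z               ≡⟨ R.*-identityˡ z ⟩
    z                    ∎

  product-zero : ∀ {s t w} → s ≡ 0# ⊎ t ≡ 0# ⊎ w ≡ 0# → s * t * w ≡ 0#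
  product-zero {t = t} {w}     (inj₁ refl)        = trans (cong (_* w) (R.zeroˡ t)) (R.zeroˡ w)
  product-zero {s = s} {w = w} (inj₂ (inj₁ refl)) = trans (cong (_* w) (R.zeroʳ s)) (R.zeroˡ w)
  product-zero {s = s} {t}     (inj₂ (inj₂ refl)) = R.zeroʳ (s * t)

  *-nonzero : ∀ {x y} → x ≢ 0# → y ≢ 0# → x * y ≢ 0#
  *-nonzero {x} {y} x≢0 y≢0 xy≡0 = y≢0 (*-cancelˡ x x≢0 (trans xy≡0 (sym (R.zeroʳ x))))

  ⁻¹-nonzero : ∀ x → x ≢ 0# → x ⁻¹ ≢ 0#
  ⁻¹-nonzero x x≢0 x⁻¹≡0 = 0≢1 (trans (sym (R.zeroʳ x)) (trans (cong (x *_) (sym x⁻¹≡0)) (inverseʳ x x≢0)))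

  to : Fin q → F
  to = Inverse.to enum

  from : F → Fin q
  from = Inverse.from enum

  to-from : ∀ x → to (from x) ≡ x
  to-from x = Inverse.inverseˡ enum refl

  from-to : ∀ i → from (to i) ≡ i
  from-to i = Inverse.inverseʳ enum refl

  from-injective : ∀ {x y} → from x ≡ from y → x ≡ y
  from-injective {x} {y} e = trans (sym (to-from x)) (trans (cong to e) (to-from y))

  from-0≢from-1 : from 0# ≢ from 1#
  from-0≢from-1 = 0≢1 ∘ from-injective

  ∈-elements : ∀ x → x ∈ elements
  ∈-elements x = subst (_∈ elements) (to-from x) (∈-map⁺ to (∈-allFin (from x)))

  permutationOf : (σ τ : F → F) → (∀ x → σ (τ x) ≡ x) → (∀ x → τ (σ x) ≡ x) → Perm.Permutation q q
  permutationOf σ τ στ τσ = Perm.permutation (from ∘ σ ∘ to) (from ∘ τ ∘ to)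
    (λ i → trans (cong (from ∘ σ) (to-from _)) (trans (cong from (στ (to i))) (from-to i)))
    (λ i → trans (cong (from ∘ τ) (to-from _)) (trans (cong from (τσ (to i))) (from-to i)))

  opaque
    ΣF : (F → ℕ) → ℕ
    ΣF w = sum (w ∘ to)

  opaque
    unfolding ΣF

    listSum-elements : (w : F → ℕ) → listSum elements w ≡ ΣF w
    listSum-elements w = trans (listSum-map to (allFin q) w) (listSum-tabulate q (λ i → i) (w ∘ to))

    ΣF-cong : {w v : F → ℕ} → (∀ x → w x ≡ v x) → ΣF w ≡ ΣF v
    ΣF-cong w≗v = sum-cong-≗ (w≗v ∘ to)

    ΣF-+ : (w v : F → ℕ) → ΣF (λ x → w x +ℕ v x) ≡ ΣF w +ℕ ΣF v
    ΣF-+ w v = ∑-distrib-+ (w ∘ to) (v ∘ to)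

    ΣF-*ˡ : (k : ℕ) (w : F → ℕ) → ΣF (λ x → k *ℕ w x) ≡ k *ℕ ΣF w
    ΣF-*ˡ k w = sym (*-distribˡ-sum k (w ∘ to))

    ΣF-comm : (w : F → F → ℕ) → ΣF (λ x → ΣF (λ y → w x y)) ≡ ΣF (λ y → ΣF (λ x → w x y))
    ΣF-comm w = ∑-comm (λ i j → w (to i) (to j))

    ΣF-const : (k : ℕ) → ΣF (λ _ → k) ≡ q *ℕ k
    ΣF-const = sum-const q

    ΣF-single : (w : F → ℕ) (a : F) → (∀ x → x ≢ a → w x ≡ 0) → ΣF w ≡ w a
    ΣF-single w a vanish =
      trans (sum-single (w ∘ to) (from a) (λ i i≢a → vanish (to i) (λ e → i≢a (trans (sym (from-to i)) (cong from e)))))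
            (cong w (to-from a))

    ΣF-reindex : (σ τ : F → F) → (∀ x → σ (τ x) ≡ x) → (∀ x → τ (σ x) ≡ x) → (w : F → ℕ) → ΣF (w ∘ σ) ≡ ΣF w
    ΣF-reindex σ τ στ τσ w = sym (trans (sum-permute (w ∘ to) (permutationOf σ τ στ τσ))
                                         (sum-cong-≗ (λ i → cong w (to-from (σ (to i))))))

    ΣF-*ʳ : (k : ℕ) (w : F → ℕ) → ΣF (λ x → w x *ℕ k) ≡ ΣF w *ℕ k
    ΣF-*ʳ k w = sym (*-distribʳ-sum k (w ∘ to))

  ΣF-one : ΣF (λ _ → 1) ≡ q
  ΣF-one = trans (ΣF-const 1) (ℕP.*-identityʳ q)

  count : {P : F → Set} → (∀ x → Dec (P x)) → ℕ
  count P? = ΣF (λ x → 𝟙 (P? x))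

  count-none : {P : F → Set} (P? : ∀ x → Dec (P x)) → (∀ x → ¬ P x) → count P? ≡ 0
  count-none P? none = trans (ΣF-cong (λ x → 𝟙-no (P? x) (none x))) (trans (ΣF-const 0) (ℕP.*-zeroʳ q))

  count-unique : {P : F → Set} (P? : ∀ x → Dec (P x)) (a : F) → (∀ x → P x ⇔ x ≡ a) → count P? ≡ 1
  count-unique P? a P⇔a = trans (ΣF-single (𝟙 ∘ P?) a (λ x x≢a → 𝟙-no (P? x) (x≢a ∘ Equivalence.to (P⇔a x))))
                                (𝟙-yes (P? a) (Equivalence.from (P⇔a a) refl))

  count-≡ : (a : F) → count (_≟ a) ≡ 1
  count-≡ a = count-unique (_≟ a) a (λ _ → mk⇔ (λ e → e) (λ e → e))

  count-pair : {P : F → Set} (P? : ∀ x → Dec (P x)) (a b : F) → a ≢ b →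
               (∀ x → P x ⇔ (x ≡ a ⊎ x ≡ b)) → count P? ≡ 2
  count-pair P? a b a≢b P⇔ab = begin
      ΣF (λ x → 𝟙 (P? x))                      ≡⟨ ΣF-cong (λ x → split x (P? x) (x ≟ a) (x ≟ b)) ⟩
      ΣF (λ x → 𝟙 (x ≟ a) +ℕ 𝟙 (x ≟ b))        ≡⟨ ΣF-+ (λ x → 𝟙 (x ≟ a)) (λ x → 𝟙 (x ≟ b)) ⟩
      ΣF (λ x → 𝟙 (x ≟ a)) +ℕ ΣF (λ x → 𝟙 (x ≟ b)) ≡⟨ cong₂ _+ℕ_ (count-≡ a) (count-≡ b) ⟩
      2                                        ∎
    where
    split : ∀ x (p : Dec _) (da : Dec (x ≡ a)) (db : Dec (x ≡ b)) → 𝟙 p ≡ 𝟙 da +ℕ 𝟙 db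
    split x p       (yes refl) (yes refl) = ⊥-elim (a≢b refl)
    split x p       (yes x≡a)  (no _)     = 𝟙-yes p (Equivalence.from (P⇔ab x) (inj₁ x≡a))
    split x p       (no _)     (yes x≡b)  = 𝟙-yes p (Equivalence.from (P⇔ab x) (inj₂ x≡b))
    split x p       (no x≢a)   (no x≢b)   = 𝟙-no p ([ x≢a , x≢b ] ∘ Equivalence.to (P⇔ab x))

  count-complement : {P : F → Set} (P? : ∀ x → Dec (P x)) → count (¬? ∘ P?) ≡ q ∸ count P?
  count-complement P? = begin
      count (¬? ∘ P?)                       ≡⟨ sym (ℕP.m+n∸m≡n (count P?) _) ⟩
      count P? +ℕ count (¬? ∘ P?) ∸ count P? ≡⟨ cong (_∸ count P?) (sym (ΣF-+ (𝟙 ∘ P?) (𝟙 ∘ ¬? ∘ P?))) ⟩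
      ΣF (λ x → 𝟙 (P? x) +ℕ 𝟙 (¬? (P? x))) ∸ count P? ≡⟨ cong (_∸ count P?) (ΣF-cong (𝟙-¬ ∘ P?)) ⟩
      ΣF (λ _ → 1) ∸ count P?               ≡⟨ cong (_∸ count P?) ΣF-one ⟩
      q ∸ count P?                          ∎

  count-≢ : (a : F) → count (λ x → ¬? (x ≟ a)) ≡ q ∸ 1
  count-≢ a = trans (count-complement (_≟ a)) (cong (q ∸_) (count-≡ a))

  count-≢₂ : (a b : F) → a ≢ b → count (λ x → ¬? (x ≟ a) ×-dec ¬? (x ≟ b)) ≡ q ∸ 2
  count-≢₂ a b a≢b = begin
      count (λ x → ¬? (x ≟ a) ×-dec ¬? (x ≟ b)) ≡⟨ ΣF-cong (λ x → 𝟙-cong (¬? (x ≟ a) ×-dec ¬? (x ≟ b)) (¬? (a-or-b x))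
                                                      (λ (x≢a , x≢b) → [ x≢a , x≢b ])
                                                      (λ ¬ab → (¬ab ∘ inj₁) , (¬ab ∘ inj₂))) ⟩
      count (¬? ∘ a-or-b)                    ≡⟨ count-complement a-or-b ⟩
      q ∸ count a-or-b                       ≡⟨ cong (q ∸_) (count-pair a-or-b a b a≢b (λ _ → mk⇔ (λ e → e) (λ e → e))) ⟩
      q ∸ 2                                  ∎
    where
    a-or-b : ∀ x → Dec (x ≡ a ⊎ x ≡ b)
    a-or-b x = (x ≟ a) ⊎-dec (x ≟ b)

  -- An involution of F with exactly one fixed point a pairs off the other elements (x with σ x,
  -- the member with smaller index counted once), so q is odd.
  involution-odd : (σ : F → F) → (∀ x → σ (σ x) ≡ x) → (a : F) → σ a ≡ a → (∀ x → σ x ≡ x → x ≡ a) →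
                   ∃ λ k → q ≡ suc (2 *ℕ k)
  involution-odd σ σσ a σa≡a fixed = k , (begin
      q                                                     ≡⟨ sym ΣF-one ⟩
      ΣF (λ _ → 1)                                          ≡⟨ ΣF-cong orbit-split ⟩
      ΣF (λ x → 𝟙 (x ≟ a) +ℕ (lower x +ℕ lower (σ x)))     ≡⟨ ΣF-+ (λ x → 𝟙 (x ≟ a)) (λ x → lower x +ℕ lower (σ x)) ⟩
      count (_≟ a) +ℕ ΣF (λ x → lower x +ℕ lower (σ x))    ≡⟨ cong₂ _+ℕ_ (count-≡ a)
                                                                            (ΣF-+ lower (lower ∘ σ)) ⟩
      suc (k +ℕ ΣF (lower ∘ σ))                             ≡⟨ cong (λ z → suc (k +ℕ z)) (ΣF-reindex σ σ σσ σσ lower) ⟩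
      suc (k +ℕ k)                                          ≡⟨ cong (λ z → suc (k +ℕ z)) (sym (ℕP.+-identityʳ k)) ⟩
      suc (2 *ℕ k)                                          ∎)
    where
    Lower? : ∀ x → Dec (from x Fin.< from (σ x))
    Lower? x = from x FinP.<? from (σ x)
    lower : F → ℕ
    lower = 𝟙 ∘ Lower?
    k : ℕ
    k = count Lower?
    σ-twice : ∀ x → from (σ x) Fin.< from (σ (σ x)) → from (σ x) Fin.< from x
    σ-twice x = subst (λ y → from (σ x) Fin.< from y) (σσ x)
    orbit-split : ∀ x → 1 ≡ 𝟙 (x ≟ a) +ℕ (lower x +ℕ lower (σ x))
    orbit-split x with x ≟ a | FinP.<-cmp (from x) (from (σ x))
    ... | yes refl | _ = sym (cong suc (cong₂ _+ℕ_
          (𝟙-no (Lower? x) (FinP.<-irrefl (cong from (sym σa≡a))))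
          (𝟙-no (Lower? (σ x)) (λ lt → FinP.<-irrefl (cong from σa≡a) (σ-twice x lt)))))
    ... | no _ | tri< lt _ _ = sym (cong₂ _+ℕ_ (𝟙-yes (Lower? x) lt) (𝟙-no (Lower? (σ x)) (FinP.<-asym lt ∘ σ-twice x)))
    ... | no x≢a | tri≈ _ eq _ = ⊥-elim (x≢a (fixed x (sym (from-injective eq))))
    ... | no _ | tri> _ _ gt = sym (cong₂ _+ℕ_ (𝟙-no (Lower? x) (FinP.<-asym gt))
                                               (𝟙-yes (Lower? (σ x)) (subst (λ y → from (σ x) Fin.< from y) (sym (σσ x)) gt)))

  -- F has characteristic 2: otherwise negation would be an involution fixing only 0, making q = 2 ^ m odd.
  characteristic-two : 1# + 1# ≡ 0#
  characteristic-two with (1# + 1#) ≟ 0#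
  ... | yes two≡0 = two≡0
  ... | no two≢0 = ⊥-elim (ℕP.even≢odd (proj₁ q-even) (proj₁ q-odd) (trans (sym (proj₂ q-even)) (proj₂ q-odd)))
    where
    q-even : ∃ λ k → q ≡ 2 *ℕ k
    q-even = power-of-two-even m (from 0#) (from 1#) from-0≢from-1
    negation-fixed : ∀ x → - x ≡ x → x ≡ 0#
    negation-fixed x -x≡x = *-cancelˡ (1# + 1#) two≢0 (begin
      (1# + 1#) * x          ≡⟨ R.distribʳ x 1# 1# ⟩
      1# * x + 1# * x        ≡⟨ cong₂ _+_ (R.*-identityˡ x) (trans (R.*-identityˡ x) (sym -x≡x)) ⟩
      x + - x                ≡⟨ R.-‿inverseʳ x ⟩
      0#                     ≡⟨ sym (R.zeroʳ (1# + 1#)) ⟩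
      (1# + 1#) * 0#         ∎)
    q-odd : ∃ λ k → q ≡ suc (2 *ℕ k)
    q-odd = involution-odd -_ ⁻¹-involutive 0# ε⁻¹≈ε negation-fixed

  open CommutativeMonoidSum (CommutativeRing.*-commutativeMonoid ring)
    using () renaming (sum to product; sum-permute to product-permute; sum-cong-≗ to product-cong;
                       ∑-distrib-+ to product-distrib; sum-remove to product-remove)

  product-const : ∀ n x → product {n} (λ _ → x) ≡ x ^ᶠ n
  product-const zero    x = refl
  product-const (suc n) x = cong (x *_) (product-const n x)

  product-except : ∀ {n} (t : Fin n → F) (i : Fin n) (x : F) → (∀ j → j ≢ i → t j ≡ x) →
                   product t ≡ t i * x ^ᶠ (n ∸ 1)
  product-except {suc n} t i x rest =
    trans (product-remove {i = i} t)
          (cong (t i *_) (trans (product-cong (λ j → rest _ (FinP.punchInᵢ≢i i j))) (product-const n x)))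

  product-nonzero : ∀ {n} (t : Fin n → F) → (∀ i → t i ≢ 0#) → product t ≢ 0#
  product-nonzero {zero}  t t≢0 = 0≢1 ∘ sym
  product-nonzero {suc n} t t≢0 = *-nonzero (t≢0 fzero) (product-nonzero (t ∘ fsuc) (t≢0 ∘ fsuc))

  ifZero : F → F → F → F
  ifZero y a b with y ≟ 0#
  ... | yes _ = a
  ... | no _  = b

  ifZero-0 : ∀ {y} a b → y ≡ 0# → ifZero y a b ≡ a
  ifZero-0 {y} a b y≡0 with y ≟ 0#
  ... | yes _   = refl
  ... | no y≢0  = ⊥-elim (y≢0 y≡0)

  ifZero-≢0 : ∀ {y} a b → y ≢ 0# → ifZero y a b ≡ b
  ifZero-≢0 {y} a b y≢0 with y ≟ 0#
  ... | yes y≡0 = ⊥-elim (y≢0 y≡0)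
  ... | no _    = refl

  cancel-inverseʳ : ∀ x y → x ≢ 0# → x * (x ⁻¹ * y) ≡ y
  cancel-inverseʳ x y x≢0 = trans (sym (R.*-assoc x (x ⁻¹) y)) (trans (cong (_* y) (inverseʳ x x≢0)) (R.*-identityˡ y))

  cancel-inverseˡ : ∀ x y → x ≢ 0# → x ⁻¹ * (x * y) ≡ y
  cancel-inverseˡ x y x≢0 = trans (sym (R.*-assoc (x ⁻¹) x y)) (trans (cong (_* y) (⁻¹-inverseˡ x x≢0)) (R.*-identityˡ y))

  -- Fermat's little theorem. Multiplying by x permutes F, so the product P of the nonzero
  -- elements satisfies P = x ^ (q - 1) * P.
  fermat : ∀ x → x ≢ 0# → x * x ^ᶠ (q ∸ 2) ≡ 1#
  fermat x x≢0 = trans (cong (x ^ᶠ_) (sym (n∸1≡suc[n∸2] q (from 0#) (from 1#) from-0≢from-1))) x^[q-1]≡1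
    where
    ΠF : (F → F) → F
    ΠF w = product (w ∘ to)
    unit : F → F
    unit y = ifZero y 1# y
    -- the factor by which unit y changes when y is multiplied by x
    factor : F → F
    factor y = ifZero y 1# x
    unit-nonzero : ∀ y → unit y ≢ 0#
    unit-nonzero y with y ≟ 0#
    ... | yes _   = 0≢1 ∘ sym
    ... | no y≢0  = y≢0
    unit-scale : ∀ y → unit (x * y) ≡ factor y * unit y
    unit-scale y with y ≟ 0#
    ... | yes y≡0 = trans (ifZero-0 1# (x * y) (trans (cong (x *_) y≡0) (R.zeroʳ x))) (sym (R.*-identityˡ 1#))
    ... | no y≢0  = ifZero-≢0 1# (x * y) (*-nonzero x≢0 y≢0)
    scaling : ΠF unit ≡ ΠF factor * ΠF unit
    scaling = begin
      ΠF unit                                 ≡⟨ product-permute (unit ∘ to) (permutationOf (x *_) (x ⁻¹ *_)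
                                                   (λ y → cancel-inverseʳ x y x≢0) (λ y → cancel-inverseˡ x y x≢0)) ⟩
      product (λ i → unit (to (from (x * to i)))) ≡⟨ product-cong (λ i → cong unit (to-from (x * to i))) ⟩
      ΠF (λ y → unit (x * y))                 ≡⟨ product-cong (unit-scale ∘ to) ⟩
      ΠF (λ y → factor y * unit y)            ≡⟨ product-distrib (factor ∘ to) (unit ∘ to) ⟩
      ΠF factor * ΠF unit                     ∎
    factors≡1 : ΠF factor ≡ 1#
    factors≡1 = *-cancelˡ (ΠF unit) (product-nonzero (unit ∘ to) (unit-nonzero ∘ to))
                  (trans (R.*-comm (ΠF unit) (ΠF factor)) (trans (sym scaling) (sym (R.*-identityʳ (ΠF unit)))))
    x^[q-1]≡1 : x ^ᶠ (q ∸ 1) ≡ 1#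
    x^[q-1]≡1 = begin
      x ^ᶠ (q ∸ 1)                     ≡⟨ sym (R.*-identityˡ _) ⟩
      1# * x ^ᶠ (q ∸ 1)                ≡⟨ cong (_* x ^ᶠ (q ∸ 1)) (sym (ifZero-0 1# x (to-from 0#))) ⟩
      factor (to (from 0#)) * x ^ᶠ (q ∸ 1) ≡⟨ sym (product-except (factor ∘ to) (from 0#) x
                                                 (λ j j≢0 → ifZero-≢0 1# x (j≢0 ∘ trans (sym (from-to j)) ∘ cong from))) ⟩
      ΠF factor                        ≡⟨ factors≡1 ⟩
      1#                               ∎

  -- A ring solver for F with coefficients in GF(2) = (Bool, xor, ∧); it knows that x + x = 0.
  private
    GF2 : RawRing _ _
    GF2 = record { Carrier = Bool ; _≈_ = _≡_ ; _+_ = _xor_ ; _*_ = _∧_ ; -_ = λ b → b ; 0# = false ; 1# = true }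

    ⟦_⟧₂ : Bool → F
    ⟦ true  ⟧₂ = 1#
    ⟦ false ⟧₂ = 0#

    -1≡1 : - 1# ≡ 1#
    -1≡1 = sym (inverseʳ-unique 1# 1# characteristic-two)

    GF2⟶F : GF2 ACR.-Raw-AlmostCommutative⟶ ACR.fromCommutativeRing ring
    GF2⟶F = record
      { ⟦_⟧    = ⟦_⟧₂
      ; +-homo = λ { true true → sym characteristic-two ; true false → sym (R.+-identityʳ 1#) ; false y → sym (R.+-identityˡ _) }
      ; *-homo = λ { true y → sym (R.*-identityˡ _) ; false y → sym (R.zeroˡ _) }
      ; -‿homo = λ { true → sym -1≡1 ; false → sym ε⁻¹≈ε }
      ; 0-homo = refl
      ; 1-homo = refl
      }

    GF2-equal? : ∀ a b → Maybe (⟦ a ⟧₂ ≡ ⟦ b ⟧₂)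
    GF2-equal? true  true  = just refl
    GF2-equal? false false = just refl
    GF2-equal? _     _     = nothing

  module Char2 = RingSolver GF2 (ACR.fromCommutativeRing ring) GF2⟶F GF2-equal?
  open Char2 using (con) renaming (_:+_ to _⊕_; _:*_ to _⊗_; _:=_ to _⊜_)

  x+x≡0 : ∀ x → x + x ≡ 0#
  x+x≡0 = Char2.solve 1 (λ x → x ⊕ x ⊜ con false) refl

  add-twice : ∀ x y → (x + y) + y ≡ x
  add-twice = Char2.solve 2 (λ x y → (x ⊕ y) ⊕ y ⊜ x) refl

  move-right : ∀ {x y z} → x + y ≡ z → x ≡ z + y
  move-right {x} {y} x+y≡z = trans (sym (add-twice x y)) (cong (_+ y) x+y≡z)

  sum-zero⇒equal : ∀ {x y} → x + y ≡ 0# → x ≡ y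
  sum-zero⇒equal {x} {y} x+y≡0 = trans (move-right x+y≡0) (R.+-identityˡ y)

  equal⇒sum-zero : ∀ {x y} → x ≡ y → x + y ≡ 0#
  equal⇒sum-zero {x} refl = x+x≡0 x

  divide : ∀ {a N Δ} → Δ ≢ 0# → a * Δ ≡ N → a ≡ N * Δ ⁻¹
  divide {a} {N} {Δ} Δ≢0 aΔ≡N = begin
    a                ≡⟨ sym (R.*-identityʳ a) ⟩
    a * 1#           ≡⟨ cong (a *_) (sym (inverseʳ Δ Δ≢0)) ⟩
    a * (Δ * Δ ⁻¹)   ≡⟨ sym (R.*-assoc a Δ (Δ ⁻¹)) ⟩
    a * Δ * Δ ⁻¹     ≡⟨ cong (_* Δ ⁻¹) aΔ≡N ⟩
    N * Δ ⁻¹         ∎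

  divided : ∀ N {Δ} → Δ ≢ 0# → N * Δ ⁻¹ * Δ ≡ N
  divided N {Δ} Δ≢0 = trans (R.*-assoc N (Δ ⁻¹) Δ) (trans (cong (N *_) (⁻¹-inverseˡ Δ Δ≢0)) (R.*-identityʳ N))

  -- Cramer's rule (in characteristic 2) for the system  a p₁ + b r₁ = v₁,  a p₂ + b r₂ = v₂
  -- with nonzero determinant Δ = p₁ r₂ + p₂ r₁.
  module Cramer (p₁ r₁ v₁ p₂ r₂ v₂ : F) (Δ≢0 : p₁ * r₂ + p₂ * r₁ ≢ 0#) where
    Δ a₀ b₀ : F
    Δ  = p₁ * r₂ + p₂ * r₁
    a₀ = (v₁ * r₂ + v₂ * r₁) * Δ ⁻¹
    b₀ = (p₁ * v₂ + p₂ * v₁) * Δ ⁻¹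

    Solves : F → F → Set
    Solves a b = (a * p₁ + b * r₁ ≡ v₁) × (a * p₂ + b * r₂ ≡ v₂)

    eliminate-b : ∀ a b → a * Δ ≡ (a * p₁ + b * r₁) * r₂ + (a * p₂ + b * r₂) * r₁
    eliminate-b a b = Char2.solve 6
      (λ a b p₁ r₁ p₂ r₂ → a ⊗ (p₁ ⊗ r₂ ⊕ p₂ ⊗ r₁)
                          ⊜ (a ⊗ p₁ ⊕ b ⊗ r₁) ⊗ r₂ ⊕ (a ⊗ p₂ ⊕ b ⊗ r₂) ⊗ r₁)
      refl a b p₁ r₁ p₂ r₂

    eliminate-a : ∀ a b → b * Δ ≡ p₁ * (a * p₂ + b * r₂) + p₂ * (a * p₁ + b * r₁)
    eliminate-a a b = Char2.solve 6
      (λ a b p₁ r₁ p₂ r₂ → b ⊗ (p₁ ⊗ r₂ ⊕ p₂ ⊗ r₁)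
                          ⊜ p₁ ⊗ (a ⊗ p₂ ⊕ b ⊗ r₂) ⊕ p₂ ⊗ (a ⊗ p₁ ⊕ b ⊗ r₁))
      refl a b p₁ r₁ p₂ r₂

    solution-unique : ∀ {a b} → Solves a b → a ≡ a₀ × b ≡ b₀
    solution-unique {a} {b} (eq₁ , eq₂) =
        divide Δ≢0 (trans (eliminate-b a b) (cong₂ (λ s t → s * r₂ + t * r₁) eq₁ eq₂))
      , divide Δ≢0 (trans (eliminate-a a b) (cong₂ (λ s t → p₁ * s + p₂ * t) eq₂ eq₁))

    solution-valid : Solves a₀ b₀
    solution-valid = row p₁ r₁ v₁ (Char2.solve 6
                       (λ v₁ v₂ p₁ r₁ p₂ r₂ → (v₁ ⊗ r₂ ⊕ v₂ ⊗ r₁) ⊗ p₁ ⊕ (p₁ ⊗ v₂ ⊕ p₂ ⊗ v₁) ⊗ r₁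
                                             ⊜ v₁ ⊗ (p₁ ⊗ r₂ ⊕ p₂ ⊗ r₁))
                       refl v₁ v₂ p₁ r₁ p₂ r₂)
                   , row p₂ r₂ v₂ (Char2.solve 6
                       (λ v₁ v₂ p₁ r₁ p₂ r₂ → (v₁ ⊗ r₂ ⊕ v₂ ⊗ r₁) ⊗ p₂ ⊕ (p₁ ⊗ v₂ ⊕ p₂ ⊗ v₁) ⊗ r₂
                                             ⊜ v₂ ⊗ (p₁ ⊗ r₂ ⊕ p₂ ⊗ r₁))
                       refl v₁ v₂ p₁ r₁ p₂ r₂)
      where
      row : ∀ p r v → (v₁ * r₂ + v₂ * r₁) * p + (p₁ * v₂ + p₂ * v₁) * r ≡ v * Δ → a₀ * p + b₀ * r ≡ v
      row p r v scaled = *-cancelˡ Δ Δ≢0 (begin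
        Δ * (a₀ * p + b₀ * r)        ≡⟨ Char2.solve 5 (λ Δ a b p r → Δ ⊗ (a ⊗ p ⊕ b ⊗ r) ⊜ (a ⊗ Δ) ⊗ p ⊕ (b ⊗ Δ) ⊗ r)
                                          refl Δ a₀ b₀ p r ⟩
        a₀ * Δ * p + b₀ * Δ * r      ≡⟨ cong₂ (λ s t → s * p + t * r) (divided _ Δ≢0) (divided _ Δ≢0) ⟩
        (v₁ * r₂ + v₂ * r₁) * p + (p₁ * v₂ + p₂ * v₁) * r ≡⟨ scaled ⟩
        v * Δ                        ≡⟨ R.*-comm v Δ ⟩
        Δ * v                        ∎)

  affine-solve : ∀ {k t c u} → k ≢ 0# → (k * t + c ≡ u ⇔ t ≡ k ⁻¹ * (u + c))
  affine-solve {k} {t} {c} {u} k≢0 = mk⇔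
    (λ eq → trans (sym (cancel-inverseˡ k t k≢0)) (cong (k ⁻¹ *_) (move-right eq)))
    (λ t≡ → trans (cong (λ s → k * s + c) t≡) (trans (cong (_+ c) (cancel-inverseʳ k (u + c) k≢0)) (add-twice u c)))

  χ-nonzero : ∀ x → χ (nonzero x) ≡ 𝟙 (¬? (x ≟ 0#))
  χ-nonzero x with x ≟ 0#
  ... | yes _ = refl
  ... | no _  = refl

  Σ3 : (F → F → F → ℕ) → ℕ
  Σ3 w = ΣF λ a → ΣF λ b → ΣF λ c → w a b c

  Σ3-cong : {w v : F → F → F → ℕ} → (∀ a b c → w a b c ≡ v a b c) → Σ3 w ≡ Σ3 v
  Σ3-cong w≗v = ΣF-cong λ a → ΣF-cong λ b → ΣF-cong λ c → w≗v a b c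

  Σ3-+ : (w v : F → F → F → ℕ) → Σ3 (λ a b c → w a b c +ℕ v a b c) ≡ Σ3 w +ℕ Σ3 v
  Σ3-+ w v = trans (ΣF-cong λ a → trans (ΣF-cong λ b → ΣF-+ (w a b) (v a b)) (ΣF-+ (λ b → ΣF (w a b)) (λ b → ΣF (v a b))))
                   (ΣF-+ (λ a → ΣF λ b → ΣF (w a b)) (λ a → ΣF λ b → ΣF (v a b)))

  Σ3-*ˡ : (k : ℕ) (w : F → F → F → ℕ) → Σ3 (λ a b c → k *ℕ w a b c) ≡ k *ℕ Σ3 w
  Σ3-*ˡ k w = trans (ΣF-cong λ a → trans (ΣF-cong λ b → ΣF-*ˡ k (w a b)) (ΣF-*ˡ k (λ b → ΣF (w a b))))
                    (ΣF-*ˡ k (λ a → ΣF λ b → ΣF (w a b)))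

  -- (an instance of Σ3-*ˡ, as 0 * n reduces to 0)
  Σ3-zero : Σ3 (λ _ _ _ → 0) ≡ 0
  Σ3-zero = Σ3-*ˡ 0 (λ _ _ _ → 0)

  Σ3-product : (w₁ w₂ w₃ : F → ℕ) → Σ3 (λ a b c → w₁ a *ℕ (w₂ b *ℕ w₃ c)) ≡ ΣF w₁ *ℕ (ΣF w₂ *ℕ ΣF w₃)
  Σ3-product w₁ w₂ w₃ = begin
    Σ3 (λ a b c → w₁ a *ℕ (w₂ b *ℕ w₃ c))
      ≡⟨ ΣF-cong (λ a → ΣF-cong λ b → trans (ΣF-*ˡ (w₁ a) _) (cong (w₁ a *ℕ_) (ΣF-*ˡ (w₂ b) w₃))) ⟩
    ΣF (λ a → ΣF (λ b → w₁ a *ℕ (w₂ b *ℕ ΣF w₃)))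
      ≡⟨ ΣF-cong (λ a → trans (ΣF-*ˡ (w₁ a) _) (cong (w₁ a *ℕ_) (ΣF-*ʳ (ΣF w₃) w₂))) ⟩
    ΣF (λ a → w₁ a *ℕ (ΣF w₂ *ℕ ΣF w₃))
      ≡⟨ ΣF-*ʳ (ΣF w₂ *ℕ ΣF w₃) w₁ ⟩
    ΣF w₁ *ℕ (ΣF w₂ *ℕ ΣF w₃)
      ∎

  Σ3-product₂ : (w₁ w₂ : F → ℕ) → Σ3 (λ a b c → w₁ a *ℕ w₂ b) ≡ ΣF w₁ *ℕ (ΣF w₂ *ℕ q)
  Σ3-product₂ w₁ w₂ = begin
    Σ3 (λ a b c → w₁ a *ℕ w₂ b)               ≡⟨ Σ3-cong (λ a b c → cong (w₁ a *ℕ_) (sym (ℕP.*-identityʳ (w₂ b)))) ⟩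
    Σ3 (λ a b c → w₁ a *ℕ (w₂ b *ℕ 1))        ≡⟨ Σ3-product w₁ w₂ (λ _ → 1) ⟩
    ΣF w₁ *ℕ (ΣF w₂ *ℕ ΣF (λ _ → 1))          ≡⟨ cong (λ t → ΣF w₁ *ℕ (ΣF w₂ *ℕ t)) ΣF-one ⟩
    ΣF w₁ *ℕ (ΣF w₂ *ℕ q)                     ∎

  Σ3-unique : {P : F → F → F → Set} (P? : ∀ a b c → Dec (P a b c)) (a₀ b₀ c₀ : F) →
              (∀ a b c → P a b c ⇔ (a ≡ a₀ × b ≡ b₀ × c ≡ c₀)) → Σ3 (λ a b c → 𝟙 (P? a b c)) ≡ 1
  Σ3-unique P? a₀ b₀ c₀ P⇔ = begin
      Σ3 (λ a b c → 𝟙 (P? a b c))                              ≡⟨ Σ3-cong at-point ⟩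
      Σ3 (λ a b c → 𝟙 (a ≟ a₀) *ℕ (𝟙 (b ≟ b₀) *ℕ 𝟙 (c ≟ c₀))) ≡⟨ Σ3-product _ _ _ ⟩
      count (_≟ a₀) *ℕ (count (_≟ b₀) *ℕ count (_≟ c₀))        ≡⟨ cong₂ _*ℕ_ (count-≡ a₀) (cong₂ _*ℕ_ (count-≡ b₀) (count-≡ c₀)) ⟩
      1                                                        ∎
    where
    at-point : ∀ a b c → 𝟙 (P? a b c) ≡ 𝟙 (a ≟ a₀) *ℕ (𝟙 (b ≟ b₀) *ℕ 𝟙 (c ≟ c₀))
    at-point a b c = begin
      𝟙 (P? a b c)                                   ≡⟨ 𝟙-cong (P? a b c) ((a ≟ a₀) ×-dec ((b ≟ b₀) ×-dec (c ≟ c₀)))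
                                                          (Equivalence.to (P⇔ a b c)) (Equivalence.from (P⇔ a b c)) ⟩
      𝟙 ((a ≟ a₀) ×-dec ((b ≟ b₀) ×-dec (c ≟ c₀)))   ≡⟨ 𝟙-× (a ≟ a₀) ((b ≟ b₀) ×-dec (c ≟ c₀)) ⟩
      𝟙 (a ≟ a₀) *ℕ 𝟙 ((b ≟ b₀) ×-dec (c ≟ c₀))      ≡⟨ cong (𝟙 (a ≟ a₀) *ℕ_) (𝟙-× (b ≟ b₀) (c ≟ c₀)) ⟩
      𝟙 (a ≟ a₀) *ℕ (𝟙 (b ≟ b₀) *ℕ 𝟙 (c ≟ c₀))      ∎

  Σ3-comm : (w : F → F → F → F → F → F → ℕ) →
            Σ3 (λ a b c → Σ3 (λ x y z → w a b c x y z)) ≡ Σ3 (λ x y z → Σ3 (λ a b c → w a b c x y z))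
  Σ3-comm w = trans (ΣF-cong λ a → trans (ΣF-cong λ b → ΣF-Σ3 (w a b)) (ΣF-Σ3 _)) (ΣF-Σ3 _)
    where
    ΣF-Σ3 : (v : F → F → F → F → ℕ) → ΣF (λ a → Σ3 (v a)) ≡ Σ3 (λ x y z → ΣF (λ a → v a x y z))
    ΣF-Σ3 v = trans (ΣF-comm _) (ΣF-cong λ x → trans (ΣF-comm _) (ΣF-cong λ y → ΣF-comm _))

  Distinct? : ∀ x₁ x₂ x₃ → Dec (x₂ ≢ x₁ × x₃ ≢ x₁ × x₃ ≢ x₂)
  Distinct? x₁ x₂ x₃ = ¬? (x₂ ≟ x₁) ×-dec (¬? (x₃ ≟ x₁) ×-dec ¬? (x₃ ≟ x₂))

  count-distinct : Σ3 (λ x₁ x₂ x₃ → 𝟙 (Distinct? x₁ x₂ x₃)) ≡ q *ℕ (q ∸ 1) *ℕ (q ∸ 2)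
  count-distinct = begin
      Σ3 (λ x₁ x₂ x₃ → 𝟙 (Distinct? x₁ x₂ x₃))            ≡⟨ ΣF-cong (λ x₁ → ΣF-cong (third-point x₁)) ⟩
      ΣF (λ x₁ → ΣF (λ x₂ → 𝟙 (¬? (x₂ ≟ x₁)) *ℕ (q ∸ 2))) ≡⟨ ΣF-cong second-point ⟩
      ΣF (λ _ → (q ∸ 1) *ℕ (q ∸ 2))                       ≡⟨ ΣF-const _ ⟩
      q *ℕ ((q ∸ 1) *ℕ (q ∸ 2))                           ≡⟨ sym (ℕP.*-assoc q _ _) ⟩
      q *ℕ (q ∸ 1) *ℕ (q ∸ 2)                             ∎
    where
    third-point : ∀ x₁ x₂ → ΣF (λ x₃ → 𝟙 (Distinct? x₁ x₂ x₃)) ≡ 𝟙 (¬? (x₂ ≟ x₁)) *ℕ (q ∸ 2)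
    third-point x₁ x₂ =
      trans (ΣF-cong λ x₃ → 𝟙-× (¬? (x₂ ≟ x₁)) (¬? (x₃ ≟ x₁) ×-dec ¬? (x₃ ≟ x₂)))
            (trans (ΣF-*ˡ (𝟙 (¬? (x₂ ≟ x₁))) (λ x₃ → 𝟙 (¬? (x₃ ≟ x₁) ×-dec ¬? (x₃ ≟ x₂)))) (by-x₂ (x₂ ≟ x₁)))
      where
      by-x₂ : (d : Dec (x₂ ≡ x₁)) →
              𝟙 (¬? d) *ℕ count (λ x₃ → ¬? (x₃ ≟ x₁) ×-dec ¬? (x₃ ≟ x₂)) ≡ 𝟙 (¬? d) *ℕ (q ∸ 2)
      by-x₂ (yes _)     = refl
      by-x₂ (no x₂≢x₁) = cong (1 *ℕ_) (count-≢₂ x₁ x₂ (x₂≢x₁ ∘ sym))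
    second-point : ∀ x₁ → ΣF (λ x₂ → 𝟙 (¬? (x₂ ≟ x₁)) *ℕ (q ∸ 2)) ≡ (q ∸ 1) *ℕ (q ∸ 2)
    second-point x₁ = trans (ΣF-*ʳ (q ∸ 2) (λ x₂ → 𝟙 (¬? (x₂ ≟ x₁)))) (cong (_*ℕ (q ∸ 2)) (count-≢ x₁))

  preimages : (F → F) → F → ℕ
  preimages h u = count (λ x → h x ≟ u)

  preimages-valueSet : (h : F → F) (u : F) (k : ℕ) → (∀ y → h y ≡ u → preimages h u ≡ k) →
                       preimages h u ≡ k *ℕ χ (inValueSet h u)
  preimages-valueSet h u k attained = by-membership (inValueSet h u) refl
    where
    test : F → Bool
    test x = ⌊ h x ≟ u ⌋
    by-membership : ∀ v → inValueSet h u ≡ v → preimages h u ≡ k *ℕ χ v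
    by-membership true  member = trans (attained _ (toWitness (proj₂ (satisfied (any⁻ test elements (subst T (sym member) tt))))))
                                       (sym (ℕP.*-identityʳ k))
    by-membership false absent = trans (count-none _ (λ x hx≡u → subst T absent (any⁺ test (lose (∈-elements x) (fromWitness hx≡u)))))
                                       (sym (ℕP.*-zeroʳ k))

  countTrue-triples : (p : F × F × F → Bool) → countTrue p triples ≡ Σ3 (λ a b c → χ (p (a , b , c)))
  countTrue-triples p = begin
      countTrue p triples          ≡⟨ countTrue-listSum triples ⟩
      listSum triples (χ ∘ p)      ≡⟨ listSum-cartesianProduct elements _ _ ⟩
      listSum elements (λ a → listSum (cartesianProduct elements elements) (λ bc → χ (p (a , bc))))
                                   ≡⟨ listSum-cong elements (λ a → listSum-cartesianProduct elements elements _) ⟩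
      listSum elements (λ a → listSum elements λ b → listSum elements λ c → χ (p (a , b , c)))
                                   ≡⟨ trans (listSum-elements _) (ΣF-cong λ a → trans (listSum-elements _) (ΣF-cong λ b → listSum-elements _)) ⟩
      Σ3 (λ a b c → χ (p (a , b , c))) ∎
    where
    countTrue-listSum : ∀ xs → countTrue p xs ≡ listSum xs (χ ∘ p)
    countTrue-listSum []       = refl
    countTrue-listSum (x ∷ xs) with p x
    ... | true  = cong suc (countTrue-listSum xs)
    ... | false = countTrue-listSum xs

  module OPolynomial (f : Poly) (isO : IsOPolynomial f) where
    open IsOPolynomial isO

    φ : F → F
    φ = eval f

    φ-injective : ∀ {x y} → φ x ≡ φ y → x ≡ y
    φ-injective = proj₁ perm

    φ-surjective : ∀ w → ∃ λ x → φ x ≡ w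
    φ-surjective w = proj₁ (proj₂ perm w) , proj₂ (proj₂ perm w) refl

    -- The difference quotient (f(z + y) + f(y)) / z at y; the o-polynomial condition says it
    -- is a bijection in z.
    slope : F → F → F
    slope y z = (φ (z + y) + φ y) * z ^ᶠ (q ∸ 2)

    slope-injective : ∀ y {z w} → slope y z ≡ slope y w → z ≡ w
    slope-injective y = proj₁ (perm-a y)

    slope-surjective : ∀ y w → ∃ λ z → slope y z ≡ w
    slope-surjective y w = proj₁ (proj₂ (perm-a y) w) , proj₂ (proj₂ (perm-a y) w) refl

    slope-zero : ∀ y → slope y 0# ≡ 0#
    slope-zero y = begin
      (φ (0# + y) + φ y) * 0# ^ᶠ (q ∸ 2) ≡⟨ cong (λ t → (φ t + φ y) * 0# ^ᶠ (q ∸ 2)) (R.+-identityˡ y) ⟩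
      (φ y + φ y) * 0# ^ᶠ (q ∸ 2)        ≡⟨ cong (_* 0# ^ᶠ (q ∸ 2)) (x+x≡0 (φ y)) ⟩
      0# * 0# ^ᶠ (q ∸ 2)                 ≡⟨ R.zeroˡ _ ⟩
      0#                                 ∎

    -- For z ≠ 0 the slope is the quotient, by Fermat's theorem z ^ (q - 2) = 1 / z.
    slope-times : ∀ y z → z ≢ 0# → slope y z * z ≡ φ (z + y) + φ y
    slope-times y z z≢0 = begin
      (φ (z + y) + φ y) * z ^ᶠ (q ∸ 2) * z   ≡⟨ R.*-assoc _ _ z ⟩
      (φ (z + y) + φ y) * (z ^ᶠ (q ∸ 2) * z) ≡⟨ cong ((φ (z + y) + φ y) *_) (trans (R.*-comm _ z) (fermat z z≢0)) ⟩
      (φ (z + y) + φ y) * 1#                 ≡⟨ R.*-identityʳ _ ⟩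
      φ (z + y) + φ y                        ∎

    g : F → F → F → F → F
    g a b c x = a * φ x + b * x + c

    g-difference : ∀ a b c x y → g a b c x + g a b c y ≡ a * (φ x + φ y) + b * (x + y)
    g-difference a b c x y = Char2.solve 7 (λ a b c φx φy x y →
        (a ⊗ φx ⊕ b ⊗ x ⊕ c) ⊕ (a ⊗ φy ⊕ b ⊗ y ⊕ c) ⊜ a ⊗ (φx ⊕ φy) ⊕ b ⊗ (x ⊕ y)) refl a b c (φ x) (φ y) x y

    g-from-difference : ∀ a b c x₁ u₁ x u → g a b c x₁ ≡ u₁ →
                        a * (φ x + φ x₁) + b * (x + x₁) ≡ u + u₁ → g a b c x ≡ u
    g-from-difference a b c x₁ u₁ x u at-x₁ difference = begin
      g a b c x                            ≡⟨ sym (add-twice (g a b c x) (g a b c x₁)) ⟩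
      g a b c x + g a b c x₁ + g a b c x₁  ≡⟨ cong₂ _+_ (trans (g-difference a b c x x₁) difference) at-x₁ ⟩
      u + u₁ + u₁                          ≡⟨ add-twice u u₁ ⟩
      u                                    ∎

    -- With ab ≠ 0, g a b c is two-to-one: the only other point with the value of y is y + z₀,
    -- where z₀ is the point at which the slope at y equals b / a.
    module TwoToOne (a b c : F) (a≢0 : a ≢ 0#) (b≢0 : b ≢ 0#) (y : F) where
      z₀ : F
      z₀ = proj₁ (slope-surjective y (b * a ⁻¹))

      slope-z₀ : slope y z₀ ≡ b * a ⁻¹
      slope-z₀ = proj₂ (slope-surjective y (b * a ⁻¹))

      z₀≢0 : z₀ ≢ 0#
      z₀≢0 z₀≡0 = *-nonzero b≢0 (⁻¹-nonzero a a≢0) (trans (sym slope-z₀) (trans (cong (slope y) z₀≡0) (slope-zero y)))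

      value-difference : ∀ z → z ≢ 0# → g a b c (z + y) + g a b c y ≡ (a * slope y z + b) * z
      value-difference z z≢0 = begin
        g a b c (z + y) + g a b c y                   ≡⟨ g-difference a b c (z + y) y ⟩
        a * (φ (z + y) + φ y) + b * (z + y + y)       ≡⟨ cong₂ (λ s t → a * s + b * t) (sym (slope-times y z z≢0)) (add-twice z y) ⟩
        a * (slope y z * z) + b * z                   ≡⟨ Char2.solve 4 (λ a b s z → a ⊗ (s ⊗ z) ⊕ b ⊗ z ⊜ (a ⊗ s ⊕ b) ⊗ z)
                                                           refl a b (slope y z) z ⟩
        (a * slope y z + b) * z                       ∎

      same-value⇔slope : ∀ z → z ≢ 0# → (g a b c (z + y) ≡ g a b c y ⇔ slope y z ≡ b * a ⁻¹)
      same-value⇔slope z z≢0 = mk⇔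
        (λ same → divide a≢0 (trans (R.*-comm (slope y z) a) (sum-zero⇒equal (coefficient-zero same))))
        (λ slope≡ → sum-zero⇒equal (begin
          g a b c (z + y) + g a b c y  ≡⟨ value-difference z z≢0 ⟩
          (a * slope y z + b) * z      ≡⟨ cong (λ s → (a * s + b) * z) slope≡ ⟩
          (a * (b * a ⁻¹) + b) * z     ≡⟨ cong (λ s → (s + b) * z) (trans (R.*-comm a _) (divided b a≢0)) ⟩
          (b + b) * z                  ≡⟨ cong (_* z) (x+x≡0 b) ⟩
          0# * z                       ≡⟨ R.zeroˡ z ⟩
          0#                           ∎))
        where
        coefficient-zero : g a b c (z + y) ≡ g a b c y → a * slope y z + b ≡ 0#
        coefficient-zero same = *-cancelˡ z z≢0 (begin
          z * (a * slope y z + b)      ≡⟨ R.*-comm z _ ⟩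
          (a * slope y z + b) * z      ≡⟨ sym (value-difference z z≢0) ⟩
          g a b c (z + y) + g a b c y  ≡⟨ equal⇒sum-zero same ⟩
          0#                           ≡⟨ sym (R.zeroʳ z) ⟩
          z * 0#                       ∎)

      fibre : ∀ x → g a b c x ≡ g a b c y ⇔ (x ≡ y ⊎ x ≡ z₀ + y)
      fibre x = mk⇔ to-points from-points
        where
        x≡[x+y]+y : x ≡ x + y + y
        x≡[x+y]+y = sym (add-twice x y)
        to-points : g a b c x ≡ g a b c y → x ≡ y ⊎ x ≡ z₀ + y
        to-points same with (x + y) ≟ 0#
        ... | yes x+y≡0  = inj₁ (sum-zero⇒equal x+y≡0)
        ... | no x+y≢0   = inj₂ (trans x≡[x+y]+y (cong (_+ y) (slope-injective y slopes-agree)))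
          where
          slopes-agree : slope y (x + y) ≡ slope y z₀
          slopes-agree = trans (Equivalence.to (same-value⇔slope (x + y) x+y≢0)
                                                (subst (λ t → g a b c t ≡ g a b c y) x≡[x+y]+y same))
                               (sym slope-z₀)
        from-points : x ≡ y ⊎ x ≡ z₀ + y → g a b c x ≡ g a b c y
        from-points (inj₁ refl) = refl
        from-points (inj₂ refl) = Equivalence.from (same-value⇔slope z₀ z₀≢0) slope-z₀

      y≢z₀+y : y ≢ z₀ + y
      y≢z₀+y y≡z₀+y = z₀≢0 (trans (sym (add-twice z₀ y)) (trans (cong (_+ y) (sym y≡z₀+y)) (x+x≡0 y)))

    preimages-two : ∀ a b c u → a ≢ 0# → b ≢ 0# → ∀ y → g a b c y ≡ u → preimages (g a b c) u ≡ 2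
    preimages-two a b c u a≢0 b≢0 y gy≡u =
      count-pair (λ x → g a b c x ≟ u) y (z₀ + y) y≢z₀+y
        (λ x → mk⇔ (λ gx≡u → Equivalence.to (fibre x) (trans gx≡u (sym gy≡u)))
                   (λ points → trans (Equivalence.from (fibre x) points) gy≡u))
      where open TwoToOne a b c a≢0 b≢0 y

    preimages-a=0 : ∀ a b c u → a ≡ 0# → b ≢ 0# → preimages (g a b c) u ≡ 1
    preimages-a=0 a b c u a≡0 b≢0 = count-unique (λ x → g a b c x ≟ u) (b ⁻¹ * (u + c)) (λ x → mk⇔
        (λ gx≡u → Equivalence.to (affine-solve b≢0) (trans (sym (g-linear x)) gx≡u))
        (λ x≡ → trans (g-linear x) (Equivalence.from (affine-solve b≢0) x≡)))
      where
      g-linear : ∀ x → g a b c x ≡ b * x + c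
      g-linear x = begin
        a * φ x + b * x + c   ≡⟨ cong (λ s → s * φ x + b * x + c) a≡0 ⟩
        0# * φ x + b * x + c  ≡⟨ cong (λ s → s + b * x + c) (R.zeroˡ (φ x)) ⟩
        0# + b * x + c        ≡⟨ cong (_+ c) (R.+-identityˡ (b * x)) ⟩
        b * x + c             ∎

    preimages-b=0 : ∀ a b c u → b ≡ 0# → a ≢ 0# → preimages (g a b c) u ≡ 1
    preimages-b=0 a b c u b≡0 a≢0 = count-unique (λ x → g a b c x ≟ u) p (λ x → mk⇔
        (λ gx≡u → φ-injective (trans (Equivalence.to (affine-solve a≢0) (trans (sym (g-f x)) gx≡u)) (sym φp≡)))
        (λ { refl → trans (g-f p) (Equivalence.from (affine-solve a≢0) φp≡) }))
      where
      p : F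
      p = proj₁ (φ-surjective (a ⁻¹ * (u + c)))
      φp≡ : φ p ≡ a ⁻¹ * (u + c)
      φp≡ = proj₂ (φ-surjective (a ⁻¹ * (u + c)))
      g-f : ∀ x → g a b c x ≡ a * φ x + c
      g-f x = begin
        a * φ x + b * x + c   ≡⟨ cong (λ s → a * φ x + s * x + c) b≡0 ⟩
        a * φ x + 0# * x + c  ≡⟨ cong (λ s → a * φ x + s + c) (R.zeroˡ x) ⟩
        a * φ x + 0# + c      ≡⟨ cong (_+ c) (R.+-identityʳ (a * φ x)) ⟩
        a * φ x + c           ∎

    module Interpolation (x₁ x₂ x₃ u₁ u₂ u₃ : F) (x₂≢x₁ : x₂ ≢ x₁) (x₃≢x₁ : x₃ ≢ x₁) (x₃≢x₂ : x₃ ≢ x₂) where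

      Through : F → F → F → Set
      Through a b c = g a b c x₁ ≡ u₁ × g a b c x₂ ≡ u₂ × g a b c x₃ ≡ u₃

      -- The two equations relative to x₁:  a p₁ + b r₁ = v₁  and  a p₂ + b r₂ = v₂.
      p₁ r₁ v₁ p₂ r₂ v₂ : F
      p₁ = φ x₂ + φ x₁
      r₁ = x₂ + x₁
      v₁ = u₂ + u₁
      p₂ = φ x₃ + φ x₁
      r₂ = x₃ + x₁
      v₂ = u₃ + u₁

      -- The determinant is nonzero: otherwise the slopes at x₁ towards x₂ and x₃ would
      -- agree, and the o-polynomial condition would force x₂ = x₃.
      determinant-nonzero : p₁ * r₂ + p₂ * r₁ ≢ 0#
      determinant-nonzero Δ≡0 = x₃≢x₂ (begin
          x₃            ≡⟨ sym (add-twice x₃ x₁) ⟩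
          r₂ + x₁       ≡⟨ cong (_+ x₁) (slope-injective x₁ equal-slopes) ⟩
          r₁ + x₁       ≡⟨ add-twice x₂ x₁ ⟩
          x₂            ∎)
        where
        r₁≢0 : r₁ ≢ 0#
        r₁≢0 = x₂≢x₁ ∘ sum-zero⇒equal
        r₂≢0 : r₂ ≢ 0#
        r₂≢0 = x₃≢x₁ ∘ sum-zero⇒equal
        p-slope : ∀ x → x + x₁ ≢ 0# → slope x₁ (x + x₁) * (x + x₁) ≡ φ x + φ x₁
        p-slope x r≢0 = trans (slope-times x₁ (x + x₁) r≢0) (cong (λ t → φ t + φ x₁) (add-twice x x₁))
        equal-slopes : slope x₁ r₂ ≡ slope x₁ r₁
        equal-slopes = *-cancelˡ (r₁ * r₂) (*-nonzero r₁≢0 r₂≢0) (begin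
          r₁ * r₂ * slope x₁ r₂          ≡⟨ Char2.solve 3 (λ r₁ r₂ s → r₁ ⊗ r₂ ⊗ s ⊜ r₁ ⊗ (s ⊗ r₂)) refl r₁ r₂ (slope x₁ r₂) ⟩
          r₁ * (slope x₁ r₂ * r₂)        ≡⟨ cong (r₁ *_) (p-slope x₃ r₂≢0) ⟩
          r₁ * p₂                        ≡⟨ R.*-comm r₁ p₂ ⟩
          p₂ * r₁                        ≡⟨ sym (sum-zero⇒equal Δ≡0) ⟩
          p₁ * r₂                        ≡⟨ cong (_* r₂) (sym (p-slope x₂ r₁≢0)) ⟩
          slope x₁ r₁ * r₁ * r₂          ≡⟨ Char2.solve 3 (λ r₁ r₂ s → s ⊗ r₁ ⊗ r₂ ⊜ r₁ ⊗ r₂ ⊗ s) refl r₁ r₂ (slope x₁ r₁) ⟩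
          r₁ * r₂ * slope x₁ r₁          ∎)

      open Cramer p₁ r₁ v₁ p₂ r₂ v₂ determinant-nonzero public using (a₀; b₀)
      open Cramer p₁ r₁ v₁ p₂ r₂ v₂ determinant-nonzero using (solution-unique; solution-valid)

      c₀ : F
      c₀ = u₁ + (a₀ * φ x₁ + b₀ * x₁)

      through⇔ : ∀ a b c → Through a b c ⇔ (a ≡ a₀ × b ≡ b₀ × c ≡ c₀)
      through⇔ a b c = mk⇔ unique exists
        where
        unique : Through a b c → a ≡ a₀ × b ≡ b₀ × c ≡ c₀
        unique (at-x₁ , at-x₂ , at-x₃) = proj₁ a,b≡a₀,b₀ , proj₂ a,b≡a₀,b₀ , (begin
            c                                           ≡⟨ sym (Char2.solve 2 (λ A c → A ⊕ (A ⊕ c) ⊜ c) refl (a * φ x₁ + b * x₁) c) ⟩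
            a * φ x₁ + b * x₁ + (a * φ x₁ + b * x₁ + c) ≡⟨ cong (a * φ x₁ + b * x₁ +_) at-x₁ ⟩
            a * φ x₁ + b * x₁ + u₁                      ≡⟨ cong₂ (λ s t → s * φ x₁ + t * x₁ + u₁) (proj₁ a,b≡a₀,b₀) (proj₂ a,b≡a₀,b₀) ⟩
            a₀ * φ x₁ + b₀ * x₁ + u₁                    ≡⟨ R.+-comm _ u₁ ⟩
            c₀                                          ∎)
          where
          a,b≡a₀,b₀ : a ≡ a₀ × b ≡ b₀
          a,b≡a₀,b₀ = solution-unique (trans (sym (g-difference a b c x₂ x₁)) (cong₂ _+_ at-x₂ at-x₁) ,
                                       trans (sym (g-difference a b c x₃ x₁)) (cong₂ _+_ at-x₃ at-x₁))
        exists : a ≡ a₀ × b ≡ b₀ × c ≡ c₀ → Through a b c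
        exists (refl , refl , refl) = at-x₁
                                    , g-from-difference a b c x₁ u₁ x₂ u₂ at-x₁ (proj₁ solution-valid)
                                    , g-from-difference a b c x₁ u₁ x₃ u₃ at-x₁ (proj₂ solution-valid)
          where
          at-x₁ : g a b c x₁ ≡ u₁
          at-x₁ = Char2.solve 2 (λ A u → A ⊕ (u ⊕ A) ⊜ u) refl (a * φ x₁ + b * x₁) u₁

    module Count (u₁ u₂ u₃ : F) (u-distinct : ¬ ((u₁ + u₂) * (u₂ + u₃) * (u₃ + u₁) ≡ 0#)) where

      u₁≢u₂ : u₁ ≢ u₂
      u₁≢u₂ = u-distinct ∘ product-zero ∘ inj₁ ∘ equal⇒sum-zero

      u₂≢u₃ : u₂ ≢ u₃
      u₂≢u₃ = u-distinct ∘ product-zero ∘ inj₂ ∘ inj₁ ∘ equal⇒sum-zero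

      u₃≢u₁ : u₃ ≢ u₁
      u₃≢u₁ = u-distinct ∘ product-zero ∘ inj₂ ∘ inj₂ ∘ equal⇒sum-zero

      N : F → F → F → ℕ
      N a b c = preimages (g a b c) u₁ *ℕ (preimages (g a b c) u₂ *ℕ preimages (g a b c) u₃)

      Through? : ∀ a b c x₁ x₂ x₃ → Dec (g a b c x₁ ≡ u₁ × g a b c x₂ ≡ u₂ × g a b c x₃ ≡ u₃)
      Through? a b c x₁ x₂ x₃ = (g a b c x₁ ≟ u₁) ×-dec ((g a b c x₂ ≟ u₂) ×-dec (g a b c x₃ ≟ u₃))

      N-as-sum : ∀ a b c → N a b c ≡ Σ3 (λ x₁ x₂ x₃ → 𝟙 (Through? a b c x₁ x₂ x₃))
      N-as-sum a b c = trans (sym (Σ3-product _ _ _)) (Σ3-cong λ x₁ x₂ x₃ → sym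
        (trans (𝟙-× (g a b c x₁ ≟ u₁) _) (cong (𝟙 (g a b c x₁ ≟ u₁) *ℕ_) (𝟙-× (g a b c x₂ ≟ u₂) (g a b c x₃ ≟ u₃)))))

      -- Each triple of distinct points lies on exactly one g a b c through the uᵢ; points
      -- that are not distinct lie on none, since the uᵢ are distinct.
      through-count : ∀ x₁ x₂ x₃ → Σ3 (λ a b c → 𝟙 (Through? a b c x₁ x₂ x₃)) ≡ 𝟙 (Distinct? x₁ x₂ x₃)
      through-count x₁ x₂ x₃ with Distinct? x₁ x₂ x₃
      ... | yes (x₂≢x₁ , x₃≢x₁ , x₃≢x₂) = Σ3-unique (λ a b c → Through? a b c x₁ x₂ x₃) a₀ b₀ c₀ through⇔
        where open Interpolation x₁ x₂ x₃ u₁ u₂ u₃ x₂≢x₁ x₃≢x₁ x₃≢x₂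
      ... | no not-distinct = trans (Σ3-cong λ a b c → 𝟙-no (Through? a b c x₁ x₂ x₃) (not-distinct ∘ distinct a b c)) Σ3-zero
        where
        distinct : ∀ a b c → g a b c x₁ ≡ u₁ × g a b c x₂ ≡ u₂ × g a b c x₃ ≡ u₃ → x₂ ≢ x₁ × x₃ ≢ x₁ × x₃ ≢ x₂
        distinct a b c (e₁ , e₂ , e₃) =
            (λ x₂≡x₁ → u₁≢u₂ (trans (sym e₁) (trans (cong (g a b c) (sym x₂≡x₁)) e₂)))
          , (λ x₃≡x₁ → u₃≢u₁ (trans (sym e₃) (trans (cong (g a b c) x₃≡x₁) e₁)))
          , (λ x₃≡x₂ → u₂≢u₃ (trans (sym e₂) (trans (cong (g a b c) (sym x₃≡x₂)) e₃)))

      -- Double counting: the solutions (a, b, c, x₁, x₂, x₃) are in bijection with distinct triples.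
      Σ-N : Σ3 N ≡ q *ℕ (q ∸ 1) *ℕ (q ∸ 2)
      Σ-N = begin
        Σ3 N                                                            ≡⟨ Σ3-cong N-as-sum ⟩
        Σ3 (λ a b c → Σ3 (λ x₁ x₂ x₃ → 𝟙 (Through? a b c x₁ x₂ x₃)))   ≡⟨ Σ3-comm _ ⟩
        Σ3 (λ x₁ x₂ x₃ → Σ3 (λ a b c → 𝟙 (Through? a b c x₁ x₂ x₃)))   ≡⟨ Σ3-cong through-count ⟩
        Σ3 (λ x₁ x₂ x₃ → 𝟙 (Distinct? x₁ x₂ x₃))                       ≡⟨ count-distinct ⟩
        q *ℕ (q ∸ 1) *ℕ (q ∸ 2)                                         ∎

      -- For ab ≠ 0 each uᵢ has 2 or 0 preimages, so  8 · [(a, b, c) ∈ I] = [ab ≠ 0] · N a b c.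
      eight-membership : ∀ a b c → 8 *ℕ χ (inI f u₁ u₂ u₃ (a , b , c)) ≡ 𝟙 (¬? ((a * b) ≟ 0#)) *ℕ N a b c
      eight-membership a b c = begin
          8 *ℕ χ (inI f u₁ u₂ u₃ (a , b , c))
            ≡⟨ cong (8 *ℕ_) (trans (χ-∧ (nonzero (a * b)) _) (cong₂ _*ℕ_ (χ-nonzero (a * b))
                 (trans (χ-∧ (V u₁) _) (cong (χ (V u₁) *ℕ_) (χ-∧ (V u₂) (V u₃)))))) ⟩
          8 *ℕ (𝟙 (¬? ((a * b) ≟ 0#)) *ℕ (χ (V u₁) *ℕ (χ (V u₂) *ℕ χ (V u₃))))
            ≡⟨ by-ab ((a * b) ≟ 0#) ⟩
          𝟙 (¬? ((a * b) ≟ 0#)) *ℕ N a b c ∎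
        where
        V : F → Bool
        V = inValueSet (g a b c)
        by-ab : (d : Dec (a * b ≡ 0#)) →
                8 *ℕ (𝟙 (¬? d) *ℕ (χ (V u₁) *ℕ (χ (V u₂) *ℕ χ (V u₃)))) ≡ 𝟙 (¬? d) *ℕ N a b c
        by-ab (yes _)    = refl
        by-ab (no ab≢0) = trans (eight-cubes (χ (V u₁)) (χ (V u₂)) (χ (V u₃)))
                                (cong (1 *ℕ_) (sym (cong₂ _*ℕ_ (two u₁) (cong₂ _*ℕ_ (two u₂) (two u₃)))))
          where
          two : ∀ u → preimages (g a b c) u ≡ 2 *ℕ χ (V u)
          two u = preimages-valueSet (g a b c) u 2 (preimages-two a b c u
                    (λ a≡0 → ab≢0 (trans (cong (_* b) a≡0) (R.zeroˡ b)))
                    (λ b≡0 → ab≢0 (trans (cong (a *_) b≡0) (R.zeroʳ a))))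

      N-constant : ∀ {a b} c → a ≡ 0# → b ≡ 0# → N a b c ≡ 0
      N-constant {a} {b} c refl refl = by-c (c ≟ u₁)
        where
        g-constant : ∀ x → g a b c x ≡ c
        g-constant x = Char2.solve 3 (λ φx x c → con false ⊗ φx ⊕ con false ⊗ x ⊕ c ⊜ c) refl (φ x) x c
        missed : ∀ u → c ≢ u → preimages (g a b c) u ≡ 0
        missed u c≢u = count-none (λ x → g a b c x ≟ u) (λ x gx≡u → c≢u (trans (sym (g-constant x)) gx≡u))
        by-c : Dec (c ≡ u₁) → N a b c ≡ 0
        by-c (yes c≡u₁) = trans (cong (λ t → preimages (g a b c) u₁ *ℕ (t *ℕ preimages (g a b c) u₃))
                                      (missed u₂ (λ c≡u₂ → u₁≢u₂ (trans (sym c≡u₁) c≡u₂))))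
                                (ℕP.*-zeroʳ (preimages (g a b c) u₁))
        by-c (no c≢u₁)  = cong (_*ℕ (preimages (g a b c) u₂ *ℕ preimages (g a b c) u₃)) (missed u₁ c≢u₁)

      N-bijective : ∀ a b c → (∀ u → preimages (g a b c) u ≡ 1) → N a b c ≡ 1
      N-bijective a b c one = cong₂ _*ℕ_ (one u₁) (cong₂ _*ℕ_ (one u₂) (one u₃))

      ab-zero : ∀ {a b} → a * b ≡ 0# → 𝟙 (¬? ((a * b) ≟ 0#)) ≡ 0
      ab-zero {a} {b} ab≡0 = 𝟙-no (¬? ((a * b) ≟ 0#)) (λ ab≢0 → ab≢0 ab≡0)

      N-split : ∀ a b c → N a b c ≡ 𝟙 (¬? ((a * b) ≟ 0#)) *ℕ N a b c
                                    +ℕ (𝟙 (a ≟ 0#) *ℕ 𝟙 (¬? (b ≟ 0#)) +ℕ 𝟙 (¬? (a ≟ 0#)) *ℕ 𝟙 (b ≟ 0#))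
      N-split a b c with a ≟ 0# | b ≟ 0#
      ... | yes a≡0 | yes b≡0 = trans (N-constant c a≡0 b≡0)
                                  (sym (cong (_+ℕ 0) (trans (cong (k *ℕ_) (N-constant c a≡0 b≡0)) (ℕP.*-zeroʳ k))))
        where k = 𝟙 (¬? ((a * b) ≟ 0#))
      ... | yes a≡0 | no b≢0  = trans (N-bijective a b c (λ u → preimages-a=0 a b c u a≡0 b≢0))
                                  (sym (cong (λ t → t *ℕ N a b c +ℕ 1) (ab-zero (trans (cong (_* b) a≡0) (R.zeroˡ b)))))
      ... | no a≢0  | yes b≡0 = trans (N-bijective a b c (λ u → preimages-b=0 a b c u b≡0 a≢0))
                                  (sym (cong (λ t → t *ℕ N a b c +ℕ 1) (ab-zero (trans (cong (a *_) b≡0) (R.zeroʳ a)))))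
      ... | no a≢0  | no b≢0  = sym (trans (cong (λ t → t *ℕ N a b c +ℕ 0) (𝟙-yes (¬? ((a * b) ≟ 0#)) (*-nonzero a≢0 b≢0)))
                                           (trans (ℕP.+-identityʳ _) (ℕP.*-identityˡ _)))

      Σ-degenerate : Σ3 (λ a b c → 𝟙 (a ≟ 0#) *ℕ 𝟙 (¬? (b ≟ 0#)) +ℕ 𝟙 (¬? (a ≟ 0#)) *ℕ 𝟙 (b ≟ 0#))
                     ≡ 2 *ℕ (q *ℕ (q ∸ 1))
      Σ-degenerate = begin
          Σ3 (λ a b c → zero? a *ℕ nonzero? b +ℕ nonzero? a *ℕ zero? b)
            ≡⟨ Σ3-+ (λ a b c → zero? a *ℕ nonzero? b) (λ a b c → nonzero? a *ℕ zero? b) ⟩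
          Σ3 (λ a b c → zero? a *ℕ nonzero? b) +ℕ Σ3 (λ a b c → nonzero? a *ℕ zero? b)
            ≡⟨ cong₂ _+ℕ_ (Σ3-product₂ zero? nonzero?) (Σ3-product₂ nonzero? zero?) ⟩
          ΣF zero? *ℕ (ΣF nonzero? *ℕ q) +ℕ ΣF nonzero? *ℕ (ΣF zero? *ℕ q)
            ≡⟨ cong₂ (λ s t → s *ℕ (t *ℕ q) +ℕ t *ℕ (s *ℕ q)) (count-≡ 0#) (count-≢ 0#) ⟩
          1 *ℕ ((q ∸ 1) *ℕ q) +ℕ (q ∸ 1) *ℕ (1 *ℕ q)
            ≡⟨ two-products q (q ∸ 1) ⟩
          2 *ℕ (q *ℕ (q ∸ 1)) ∎
        where
        zero? nonzero? : F → ℕ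
        zero? x = 𝟙 (x ≟ 0#)
        nonzero? x = 𝟙 (¬? (x ≟ 0#))

      eight-card : Σ3 (λ a b c → 𝟙 (¬? ((a * b) ≟ 0#)) *ℕ N a b c) ≡ 8 *ℕ cardI f u₁ u₂ u₃
      eight-card = begin
        Σ3 (λ a b c → 𝟙 (¬? ((a * b) ≟ 0#)) *ℕ N a b c)   ≡⟨ Σ3-cong (λ a b c → sym (eight-membership a b c)) ⟩
        Σ3 (λ a b c → 8 *ℕ χ (inI f u₁ u₂ u₃ (a , b , c))) ≡⟨ Σ3-*ˡ 8 _ ⟩
        8 *ℕ Σ3 (λ a b c → χ (inI f u₁ u₂ u₃ (a , b , c))) ≡⟨ cong (8 *ℕ_) (sym (countTrue-triples (inI f u₁ u₂ u₃))) ⟩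
        8 *ℕ cardI f u₁ u₂ u₃                           ∎

mainTheorem9 : (m : ℕ) (K : GF2^ m) → let open GFq K in
    (f : Poly) → IsOPolynomial f →
    (u₁ u₂ u₃ : F) → ¬ ((u₁ + u₂) * (u₂ + u₃) * (u₃ + u₁) ≡ 0#) →
    cardI f u₁ u₂ u₃ ≡ (q *ℕ (q ∸ 1) *ℕ (q ∸ 4)) / 8
mainTheorem9 m K f isO u₁ u₂ u₃ u-distinct = solve-for-k q (cardI f u₁ u₂ u₃) (begin
    q *ℕ (q ∸ 1) *ℕ (q ∸ 2)                                   ≡⟨ sym Σ-N ⟩
    Σ3 N                                                      ≡⟨ Σ3-cong N-split ⟩
    Σ3 (λ a b c → nondegenerate a b c +ℕ degenerate a b)      ≡⟨ Σ3-+ nondegenerate (λ a b c → degenerate a b) ⟩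
    Σ3 nondegenerate +ℕ Σ3 (λ a b c → degenerate a b)         ≡⟨ cong₂ _+ℕ_ eight-card Σ-degenerate ⟩
    8 *ℕ cardI f u₁ u₂ u₃ +ℕ 2 *ℕ (q *ℕ (q ∸ 1))              ∎)
  where
  open GFq K
  open FiniteField K
  open OPolynomial f isO
  open Count u₁ u₂ u₃ u-distinct
  open ≡-Reasoning
  nondegenerate : F → F → F → ℕ
  nondegenerate a b c = 𝟙 (¬? ((a * b) ≟ 0#)) *ℕ N a b c
  degenerate : F → F → ℕ
  degenerate a b = 𝟙 (a ≟ 0#) *ℕ 𝟙 (¬? (b ≟ 0#)) +ℕ 𝟙 (¬? (a ≟ 0#)) *ℕ 𝟙 (b ≟ 0#)
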